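{- Let $A=(a_{ij})$ be an $n\times n$ alternating sign matrix and let $B=(b_{i,j})_{1\le j\le i\le n}$ be the monotone triangle corresponding to it (construction below). Then $\sum_{1\le i<i'\le n,\ 1\le j'\le j\le n}a_{ij}a_{i'j'}=\#\{(i,j):1\le j\le i\le n-1,\ b_{i+1,j}\le b_{i,j}=b_{i+1,j+1}-1\}$.
   Context: An alternating sign matrix of rank $n$ is an $n\times n$ matrix with the following properties: - all entries are in $\{ -1,0,1\}$; - every row and column sums to $1$; - in every row and column the nonzero entries alternate in sign. Its corresponding monotone triangle $B$ is obtained as follows: - let $c_{i,j}=\sum_{i'\le i}a_{i'j}\in\{0,1\}$; - row $i$ of $(c_{i,j})$ has exactly $i$ ones, at columns $d_{i,1}<\cdots<d_{i,i}$; - set $b_{i,j}=d_{i,j}+j-1$. -}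

module Defs where

open import Data.Nat using (ℕ; zero; suc; _+_; _∸_; _≤_; _<_; _≤?_; _<?_)
import Data.Nat as N
open import Data.Integer using (ℤ; 0ℤ; 1ℤ; -1ℤ; +_) renaming (_+_ to _+ℤ_; _*_ to _*ℤ_)
open import Data.Product using (_×_; ∃)
open import Data.Sum using (_⊎_)
open import Relation.Binary.PropositionalEquality using (_≡_; _≢_)
open import Relation.Nullary using (Dec; yes; no)
open import Relation.Nullary.Decidable using (_×-dec_)

-- All indices are 0-based natural numbers: an n×n matrix is a function
-- ℕ → ℕ → ℤ of which only the entries (i , j) with i , j < n matter.

Σℤ : ℕ → (ℕ → ℤ) → ℤ
Σℤ zero    f = 0ℤ
Σℤ (suc n) f = Σℤ n f +ℤ f n

Σℕ : ℕ → (ℕ → ℕ) → ℕ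
Σℕ zero    f = 0
Σℕ (suc n) f = Σℕ n f + f n

Matrix : Set
Matrix = ℕ → ℕ → ℤ

record IsASM (n : ℕ) (a : Matrix) : Set where
  field
    entries : ∀ i j → i < n → j < n → a i j ≡ 0ℤ ⊎ (a i j ≡ 1ℤ ⊎ a i j ≡ -1ℤ)
    rowSum  : ∀ i → i < n → Σℤ n (λ j → a i j) ≡ 1ℤ
    colSum  : ∀ j → j < n → Σℤ n (λ i → a i j) ≡ 1ℤ
    rowAlt  : ∀ i j j' → i < n → j < j' → j' < n →
              a i j ≢ 0ℤ → a i j' ≢ 0ℤ →
              (∀ k → j < k → k < j' → a i k ≡ 0ℤ) →
              a i j *ℤ a i j' ≡ -1ℤ
    colAlt  : ∀ j i i' → j < n → i < i' → i' < n →
              a i j ≢ 0ℤ → a i' j ≢ 0ℤ →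
              (∀ k → i < k → k < i' → a k j ≡ 0ℤ) →
              a i j *ℤ a i' j ≡ -1ℤ

colPartial : Matrix → ℕ → ℕ → ℤ
colPartial a i j = Σℤ (suc i) (λ i' → a i' j)

-- d i j (0-based, j ≤ i) is the (j+1)-th smallest column index of a one
-- in row i of (c i j): d i 0 < d i 1 < … < d i i list exactly the ones.
record IsOnesPositions (n : ℕ) (a : Matrix) (d : ℕ → ℕ → ℕ) : Set where
  field
    inRange   : ∀ i j → i < n → j ≤ i → d i j < n
    increasing : ∀ i j j' → i < n → j < j' → j' ≤ i → d i j < d i j'
    areOnes   : ∀ i j → i < n → j ≤ i → colPartial a i (d i j) ≡ 1ℤ
    allOnes   : ∀ i col → i < n → col < n → colPartial a i col ≡ 1ℤ →
                ∃ λ j → j ≤ i × d i j ≡ col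

-- monotone triangle entry (0-based shift of b_{i,j} = d_{i,j} + j - 1)
mt : (ℕ → ℕ → ℕ) → ℕ → ℕ → ℕ
mt d i j = d i j + j

lhs : ℕ → Matrix → ℤ
lhs n a = Σℤ n λ i → Σℤ n λ i' → Σℤ n λ j → Σℤ n λ j' →
  term i i' j j'
  where
  term : ℕ → ℕ → ℕ → ℕ → ℤ
  term i i' j j' with (i <? i') ×-dec (j' ≤? j)
  ... | yes _ = a i j *ℤ a i' j'
  ... | no  _ = 0ℤ

Cond : (ℕ → ℕ → ℕ) → ℕ → ℕ → Set
Cond d i j = mt d (suc i) j ≤ mt d i j × suc (mt d i j) ≡ mt d (suc i) (suc j)

cond? : ∀ d i j → Dec (Cond d i j)
cond? d i j = (mt d (suc i) j ≤? mt d i j) ×-dec (suc (mt d i j) N.≟ mt d (suc i) (suc j))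

indicator : ∀ {P : Set} → Dec P → ℕ
indicator (yes _) = 1
indicator (no _)  = 0

-- Right-hand side: #{(i,j) : 1 ≤ j ≤ i ≤ n-1, condition}, 0-based:
-- i ∈ {0,…,n-2}, j ∈ {0,…,i}
rhs : ℕ → (ℕ → ℕ → ℕ) → ℕ
rhs n d = Σℕ (n ∸ 1) λ i → Σℕ (suc i) λ j → indicator (cond? d i j)

-- Factoring the summand turns the left side into Σ_i Σ_j c_{i,j} · ρ_{i+1}(j), where
-- ρ_{i+1}(j) = a_{i+1,0} + ⋯ + a_{i+1,j}. In an alternating sign matrix the column partial
-- sums c_{i,j} and the row prefix sums ρ are all 0 or 1, and row i of c is supported on
-- d_{i,0} < ⋯ < d_{i,i}, so row i contributes Σ_k ρ_{i+1}(d_{i,k}). Since row i+1 of c is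
-- row i plus row i+1 of a, ρ_{i+1}(d_{i,k}) is the number of ones of row i+1 of c in the
-- columns ≤ d_{i,k} minus k+1; hence it is 1 exactly when d_{i+1,k+1} = d_{i,k}, which is the
-- counted condition b_{i,k} = b_{i+1,k+1} - 1 (then b_{i+1,k} ≤ b_{i,k} holds automatically).
module Submission where

open import Defs
open import Data.Nat using (ℕ; zero; suc; _+_; _≤_; _<_; z≤n; s≤s; _≤?_; _<?_; _≤′_; ≤′-refl; ≤′-step)
import Data.Nat.Properties as NP
open import Relation.Binary.Definitions using (tri<; tri≈; tri>)
open import Data.Integer using (ℤ; +_; -_; 0ℤ; 1ℤ; -1ℤ; +≤+)
  renaming (_+_ to _+ℤ_; _*_ to _*ℤ_; _≤_ to _≤ℤ_)
import Data.Integer.Properties as ZP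
open import Data.Product using (_×_; _,_; ∃)
open import Data.Sum using (_⊎_; inj₁; inj₂)
open import Data.Empty using (⊥-elim)
open import Function using (id; _∘_)
open import Function.Bundles using (_⇔_; mk⇔; Equivalence)
open import Function.Properties.Equivalence using () renaming (trans to ⇔-trans; sym to ⇔-sym)
open import Relation.Nullary using (Dec; yes; no; ¬_)
open import Relation.Binary.PropositionalEquality
  using (_≡_; _≢_; refl; sym; trans; cong; cong₂; subst; module ≡-Reasoning)

Σℤ-cong : ∀ n {f g : ℕ → ℤ} → (∀ t → t < n → f t ≡ g t) → Σℤ n f ≡ Σℤ n g
Σℤ-cong zero    f≡g = refl
Σℤ-cong (suc n) f≡g =
  cong₂ _+ℤ_ (Σℤ-cong n λ t t<n → f≡g t (NP.m<n⇒m<1+n t<n)) (f≡g n (NP.n<1+n n))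

Σℤ-zero : ∀ n → Σℤ n (λ _ → 0ℤ) ≡ 0ℤ
Σℤ-zero zero    = refl
Σℤ-zero (suc n) = trans (ZP.+-identityʳ _) (Σℤ-zero n)

Σℤ-ones : ∀ n → Σℤ n (λ _ → 1ℤ) ≡ + n
Σℤ-ones zero    = refl
Σℤ-ones (suc n) = trans (cong (_+ℤ 1ℤ) (Σℤ-ones n)) (cong +_ (NP.+-comm n 1))

pos-Σℕ : ∀ n (f : ℕ → ℕ) → + Σℕ n f ≡ Σℤ n (λ t → + f t)
pos-Σℕ zero    f = refl
pos-Σℕ (suc n) f = trans (ZP.pos-+ (Σℕ n f) (f n)) (cong (_+ℤ + f n) (pos-Σℕ n f))

Σℤ-distrib-+ : ∀ n (f g : ℕ → ℤ) → Σℤ n (λ t → f t +ℤ g t) ≡ Σℤ n f +ℤ Σℤ n g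
Σℤ-distrib-+ zero    f g = refl
Σℤ-distrib-+ (suc n) f g = begin
  Σℤ n (λ t → f t +ℤ g t) +ℤ (f n +ℤ g n)  ≡⟨ cong (_+ℤ (f n +ℤ g n)) (Σℤ-distrib-+ n f g) ⟩
  (F +ℤ G) +ℤ (f n +ℤ g n)                 ≡⟨ ZP.+-assoc F G _ ⟩
  F +ℤ (G +ℤ (f n +ℤ g n))                 ≡⟨ cong (F +ℤ_) (ZP.+-comm G _) ⟩
  F +ℤ ((f n +ℤ g n) +ℤ G)                 ≡⟨ cong (F +ℤ_) (ZP.+-assoc (f n) (g n) G) ⟩
  F +ℤ (f n +ℤ (g n +ℤ G))                 ≡⟨ sym (ZP.+-assoc F (f n) _) ⟩
  (F +ℤ f n) +ℤ (g n +ℤ G)                 ≡⟨ cong ((F +ℤ f n) +ℤ_) (ZP.+-comm (g n) G) ⟩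
  (F +ℤ f n) +ℤ (G +ℤ g n)                 ∎
  where
  open ≡-Reasoning
  F = Σℤ n f
  G = Σℤ n g

*-distribˡ-Σℤ : ∀ n x (f : ℕ → ℤ) → x *ℤ Σℤ n f ≡ Σℤ n (λ t → x *ℤ f t)
*-distribˡ-Σℤ zero    x f = ZP.*-zeroʳ x
*-distribˡ-Σℤ (suc n) x f =
  trans (ZP.*-distribˡ-+ x (Σℤ n f) (f n)) (cong (_+ℤ x *ℤ f n) (*-distribˡ-Σℤ n x f))

*-distribʳ-Σℤ : ∀ n x (f : ℕ → ℤ) → Σℤ n f *ℤ x ≡ Σℤ n (λ t → f t *ℤ x)
*-distribʳ-Σℤ zero    x f = ZP.*-zeroˡ x
*-distribʳ-Σℤ (suc n) x f =
  trans (ZP.*-distribʳ-+ x (Σℤ n f) (f n)) (cong (_+ℤ f n *ℤ x) (*-distribʳ-Σℤ n x f))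

Σℤ-comm : ∀ m n (F : ℕ → ℕ → ℤ) →
          Σℤ m (λ s → Σℤ n (F s)) ≡ Σℤ n (λ t → Σℤ m (λ s → F s t))
Σℤ-comm zero    n F = sym (Σℤ-zero n)
Σℤ-comm (suc m) n F =
  trans (cong (_+ℤ Σℤ n (F m)) (Σℤ-comm m n F))
        (sym (Σℤ-distrib-+ n (λ t → Σℤ m (λ s → F s t)) (F m)))

Σℤ-suc : ∀ n (f : ℕ → ℤ) → Σℤ (suc n) f ≡ f 0 +ℤ Σℤ n (λ t → f (suc t))
Σℤ-suc zero    f = trans (ZP.+-identityˡ (f 0)) (sym (ZP.+-identityʳ (f 0)))
Σℤ-suc (suc n) f = trans (cong (_+ℤ f (suc n)) (Σℤ-suc n f)) (ZP.+-assoc (f 0) _ (f (suc n)))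

Σℤ-truncate : ∀ {m n} (f : ℕ → ℤ) → m ≤ n → (∀ t → m ≤ t → t < n → f t ≡ 0ℤ) →
              Σℤ n f ≡ Σℤ m f
Σℤ-truncate {m} f m≤n = go (NP.≤⇒≤′ m≤n)
  where
  go : ∀ {n} → m ≤′ n → (∀ t → m ≤ t → t < n → f t ≡ 0ℤ) → Σℤ n f ≡ Σℤ m f
  go ≤′-refl            _      = refl
  go (≤′-step {n} m≤′n) f-zero = begin
    Σℤ n f +ℤ f n  ≡⟨ cong (Σℤ n f +ℤ_) (f-zero n (NP.≤′⇒≤ m≤′n) (NP.n<1+n n)) ⟩
    Σℤ n f +ℤ 0ℤ   ≡⟨ ZP.+-identityʳ (Σℤ n f) ⟩
    Σℤ n f         ≡⟨ go m≤′n (λ t m≤t t<n → f-zero t m≤t (NP.m<n⇒m<1+n t<n)) ⟩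
    Σℤ m f         ∎
    where open ≡-Reasoning

Σℤ-mono-≤ : ∀ {m n} (f : ℕ → ℤ) → m ≤ n → (∀ t → t < n → 0ℤ ≤ℤ f t) → Σℤ m f ≤ℤ Σℤ n f
Σℤ-mono-≤ {m} f m≤n = go (NP.≤⇒≤′ m≤n)
  where
  go : ∀ {n} → m ≤′ n → (∀ t → t < n → 0ℤ ≤ℤ f t) → Σℤ m f ≤ℤ Σℤ n f
  go ≤′-refl            _         = ZP.≤-refl
  go (≤′-step {n} m≤′n) f-nonneg = begin
    Σℤ m f          ≤⟨ go m≤′n (λ t t<n → f-nonneg t (NP.m<n⇒m<1+n t<n)) ⟩
    Σℤ n f          ≡⟨ ZP.+-identityʳ (Σℤ n f) ⟨
    Σℤ n f +ℤ 0ℤ    ≤⟨ ZP.+-monoʳ-≤ (Σℤ n f) (f-nonneg n (NP.n<1+n n)) ⟩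
    Σℤ n f +ℤ f n   ∎
    where open ZP.≤-Reasoning

guard : {P : Set} → Dec P → ℤ → ℤ
guard (yes _) x = x
guard (no _)  _ = 0ℤ

guard-yes : ∀ {P : Set} (p : Dec P) {x} → P → guard p x ≡ x
guard-yes (yes _) _  = refl
guard-yes (no ¬p) p  = ⊥-elim (¬p p)

guard-no : ∀ {P : Set} (p : Dec P) {x} → ¬ P → guard p x ≡ 0ℤ
guard-no (yes p) ¬p = ⊥-elim (¬p p)
guard-no (no _)  _  = refl

Σℤ-guard : ∀ {m n} {Q : ℕ → Set} (Q? : ∀ t → Dec (Q t)) (f : ℕ → ℤ) → m ≤ n →
           (∀ t → Q t ⇔ t < m) → Σℤ n (λ t → guard (Q? t) (f t)) ≡ Σℤ m f
Σℤ-guard {m} Q? f m≤n Q⇔ =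
  trans (Σℤ-truncate _ m≤n λ t m≤t _ → guard-no (Q? t) λ q → NP.<⇒≱ (Equivalence.to (Q⇔ t) q) m≤t)
        (Σℤ-cong m λ t t<m → guard-yes (Q? t) (Equivalence.from (Q⇔ t) t<m))

-- Sums over the support of a strictly increasing enumeration

module Enumeration {n last : ℕ} {e : ℕ → ℕ}
  (e-increasing : ∀ k k' → k < k' → k' ≤ last → e k < e k')
  (e-bounded : e last < n) where

  Supported : (ℕ → ℤ) → Set
  Supported w = ∀ x → x < n → w x ≡ 0ℤ ⊎ ∃ λ k → k ≤ last × e k ≡ x

  supported-*ʳ : ∀ {w} (g : ℕ → ℤ) → Supported w → Supported (λ x → w x *ℤ g x)
  supported-*ʳ g w-supp x x<n with w-supp x x<n
  ... | inj₁ wx≡0 = inj₁ (cong (_*ℤ g x) wx≡0)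
  ... | inj₂ hit  = inj₂ hit

  e-mono : ∀ {k k'} → k ≤ k' → k' ≤ last → e k ≤ e k'
  e-mono {k} {k'} k≤k' k'≤last with NP.m≤n⇒m<n∨m≡n k≤k'
  ... | inj₁ k<k' = NP.<⇒≤ (e-increasing k k' k<k' k'≤last)
  ... | inj₂ refl = NP.≤-refl

  e-cancel-< : ∀ {k k'} → k ≤ last → e k < e k' → k < k'
  e-cancel-< {k} {k'} k≤last ek<ek' with k <? k'
  ... | yes k<k' = k<k'
  ... | no  k≮k' = ⊥-elim (NP.<⇒≱ ek<ek' (e-mono (NP.≮⇒≥ k≮k') k≤last))

  module _ {w : ℕ → ℤ} (w-supp : Supported w) where

    off-image : ∀ x → x < n → (∀ k → k ≤ last → e k ≢ x) → w x ≡ 0ℤ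
    off-image x x<n missed with w-supp x x<n
    ... | inj₁ wx≡0          = wx≡0
    ... | inj₂ (k , k≤ , ek≡x) = ⊥-elim (missed k k≤ ek≡x)

    Σℤ-below : ∀ K → K ≤ last → Σℤ (e K) w ≡ Σℤ K (λ k → w (e k))
    Σℤ-below zero _ = Σℤ-truncate w z≤n λ x _ x<e0 →
      off-image x (NP.<-trans x<e0 (NP.≤-<-trans (e-mono z≤n NP.≤-refl) e-bounded))
        λ { k k≤last refl → NP.n≮0 (e-cancel-< k≤last x<e0) }
    Σℤ-below (suc K) K<last = begin
      Σℤ (e (suc K)) w                 ≡⟨ Σℤ-truncate w (e-increasing K (suc K) (NP.n<1+n K) K<last) between ⟩
      Σℤ (e K) w +ℤ w (e K)            ≡⟨ cong (_+ℤ w (e K)) (Σℤ-below K (NP.<⇒≤ K<last)) ⟩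
      Σℤ K (λ k → w (e k)) +ℤ w (e K)  ∎
      where
      open ≡-Reasoning
      between : ∀ x → suc (e K) ≤ x → x < e (suc K) → w x ≡ 0ℤ
      between x eK<x x<esK = off-image x (NP.<-trans x<esK (NP.≤-<-trans (e-mono K<last NP.≤-refl) e-bounded))
        λ { k k≤last refl → NP.<⇒≱ (e-cancel-< (NP.<⇒≤ K<last) eK<x)
                                    (NP.≤-pred (e-cancel-< k≤last x<esK)) }

    Σℤ-all : Σℤ n w ≡ Σℤ (suc last) (λ k → w (e k))
    Σℤ-all = begin
      Σℤ n w                              ≡⟨ Σℤ-truncate w e-bounded above ⟩
      Σℤ (e last) w +ℤ w (e last)         ≡⟨ cong (_+ℤ w (e last)) (Σℤ-below last NP.≤-refl) ⟩
      Σℤ last (λ k → w (e k)) +ℤ w (e last) ∎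
      where
      open ≡-Reasoning
      above : ∀ x → suc (e last) ≤ x → x < n → w x ≡ 0ℤ
      above x elast<x x<n = off-image x x<n
        λ { k k≤last refl → NP.<⇒≱ (e-cancel-< NP.≤-refl elast<x) k≤last }

-- Alternating sequences

opposite-units : ∀ {x y} → x ≡ 1ℤ ⊎ x ≡ -1ℤ → y ≡ 1ℤ ⊎ y ≡ -1ℤ → x *ℤ y ≡ -1ℤ → y ≡ - x
opposite-units (inj₁ refl) (inj₁ refl) ()
opposite-units (inj₁ refl) (inj₂ refl) _ = refl
opposite-units (inj₂ refl) (inj₁ refl) _ = refl
opposite-units (inj₂ refl) (inj₂ refl) ()

nonzero-unit : ∀ {x} → x ≡ 0ℤ ⊎ x ≡ 1ℤ ⊎ x ≡ -1ℤ → x ≢ 0ℤ → x ≡ 1ℤ ⊎ x ≡ -1ℤ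
nonzero-unit (inj₁ x≡0) x≢0 = ⊥-elim (x≢0 x≡0)
nonzero-unit (inj₂ unit) _  = unit

unit-nonzero : ∀ {x} → x ≡ 1ℤ ⊎ x ≡ -1ℤ → x ≢ 0ℤ
unit-nonzero (inj₁ refl) ()
unit-nonzero (inj₂ refl) ()

module Alternating (f : ℕ → ℤ) (M : ℕ)
  (entries : ∀ t → t < M → f t ≡ 0ℤ ⊎ f t ≡ 1ℤ ⊎ f t ≡ -1ℤ)
  (alternates : ∀ t t' → t < t' → t' < M → f t ≢ 0ℤ → f t' ≢ 0ℤ →
                (∀ u → t < u → u < t' → f u ≡ 0ℤ) → f t *ℤ f t' ≡ -1ℤ) where

  LastNonzero : ℕ → ℕ → Set
  LastNonzero k t = t < k × f t ≢ 0ℤ × (∀ u → t < u → u < k → f u ≡ 0ℤ)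

  last-extend : ∀ {k t} → LastNonzero k t → f k ≡ 0ℤ → LastNonzero (suc k) t
  last-extend {k} (t<k , ft≢0 , gap) fk≡0 = NP.m<n⇒m<1+n t<k , ft≢0 , gap′
    where
    gap′ : ∀ u → _ < u → u < suc k → f u ≡ 0ℤ
    gap′ u t<u u<1+k with NP.m<1+n⇒m<n∨m≡n u<1+k
    ... | inj₁ u<k  = gap u t<u u<k
    ... | inj₂ refl = fk≡0

  last-new : ∀ {k} → f k ≢ 0ℤ → LastNonzero (suc k) k
  last-new {k} fk≢0 = NP.n<1+n k , fk≢0 , λ u k<u u<1+k → ⊥-elim (NP.<⇒≱ k<u (NP.≤-pred u<1+k))

  next-nonzero : ∀ {k t} → k < M → LastNonzero k t → f k ≢ 0ℤ → f k ≡ - f t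
  next-nonzero {k} {t} k<M (t<k , ft≢0 , gap) fk≢0 =
    opposite-units (nonzero-unit (entries t (NP.<-trans t<k k<M)) ft≢0)
                   (nonzero-unit (entries k k<M) fk≢0)
                   (alternates t k t<k k<M ft≢0 fk≢0 gap)

  -- s is the first nonzero entry; by alternation a prefix sum is s or 0 according as the
  -- last nonzero entry of the prefix is s or - s. A total of 1 then forces s = 1.
  data Signed (s : ℤ) (k : ℕ) : Set where
    ends-with-s  : ∀ {t} → LastNonzero k t → f t ≡ s   → Σℤ k f ≡ s  → Signed s k
    ends-with-−s : ∀ {t} → LastNonzero k t → f t ≡ - s → Σℤ k f ≡ 0ℤ → Signed s k

  data Prefix (k : ℕ) : Set where
    all-zero : (∀ u → u < k → f u ≡ 0ℤ) → Prefix k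
    signed   : ∀ s → Signed s k → Prefix k

  Signed-extend : ∀ {s k} → f k ≡ 0ℤ → Signed s k → Signed s (suc k)
  Signed-extend {s} fk≡0 (ends-with-s l ft≡s Σ≡s) =
    ends-with-s (last-extend l fk≡0) ft≡s (trans (cong₂ _+ℤ_ Σ≡s fk≡0) (ZP.+-identityʳ s))
  Signed-extend fk≡0 (ends-with-−s l ft≡−s Σ≡0) =
    ends-with-−s (last-extend l fk≡0) ft≡−s (cong₂ _+ℤ_ Σ≡0 fk≡0)

  Signed-flip : ∀ {s k} → k < M → f k ≢ 0ℤ → Signed s k → Signed s (suc k)
  Signed-flip {s} k<M fk≢0 (ends-with-s l ft≡s Σ≡s) =
    ends-with-−s (last-new fk≢0) fk≡−s (trans (cong₂ _+ℤ_ Σ≡s fk≡−s) (ZP.+-inverseʳ s))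
    where
    fk≡−s = trans (next-nonzero k<M l fk≢0) (cong -_ ft≡s)
  Signed-flip {s} k<M fk≢0 (ends-with-−s l ft≡−s Σ≡0) =
    ends-with-s (last-new fk≢0) fk≡s (trans (cong₂ _+ℤ_ Σ≡0 fk≡s) (ZP.+-identityˡ s))
    where
    fk≡s = trans (next-nonzero k<M l fk≢0) (trans (cong -_ ft≡−s) (ZP.neg-involutive s))

  Signed-step : ∀ {s k} → k < M → Signed s k → Signed s (suc k)
  Signed-step {k = k} k<M with entries k k<M
  ... | inj₁ fk≡0 = Signed-extend fk≡0
  ... | inj₂ unit = Signed-flip k<M (unit-nonzero unit)

  Prefix-step : ∀ {k} → k < M → Prefix k → Prefix (suc k)
  Prefix-step k<M (signed s σ) = signed s (Signed-step k<M σ)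
  Prefix-step {k} k<M (all-zero zeros) with entries k k<M
  ... | inj₁ fk≡0 = all-zero zeros′
    where
    zeros′ : ∀ u → u < suc k → f u ≡ 0ℤ
    zeros′ u u<1+k with NP.m<1+n⇒m<n∨m≡n u<1+k
    ... | inj₁ u<k  = zeros u u<k
    ... | inj₂ refl = fk≡0
  ... | inj₂ unit = signed (f k) (ends-with-s (last-new (unit-nonzero unit)) refl Σ≡fk)
    where
    Σ≡fk : Σℤ k f +ℤ f k ≡ f k
    Σ≡fk = trans (cong (_+ℤ f k) (trans (Σℤ-cong k zeros) (Σℤ-zero k))) (ZP.+-identityˡ (f k))

  iterate : ∀ {P : ℕ → Set} → (∀ {k} → k < M → P k → P (suc k)) →
            ∀ {k m} → k ≤ m → m ≤ M → P k → P m
  iterate {P} step {k} k≤m = go (NP.≤⇒≤′ k≤m)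
    where
    go : ∀ {m} → k ≤′ m → m ≤ M → P k → P m
    go ≤′-refl         _    = id
    go (≤′-step k≤′m) m<M = step m<M ∘ go k≤′m (NP.<⇒≤ m<M)

  Signed-total : Σℤ M f ≡ 1ℤ → ∀ {s} → Signed s M → s ≡ 1ℤ
  Signed-total total (ends-with-s  _ _ Σ≡s) = trans (sym Σ≡s) total
  Signed-total total (ends-with-−s _ _ Σ≡0) with trans (sym Σ≡0) total
  ... | ()

  Signed-binary : ∀ {k} → Signed 1ℤ k → Σℤ k f ≡ 0ℤ ⊎ Σℤ k f ≡ 1ℤ
  Signed-binary (ends-with-s  _ _ Σ≡1) = inj₂ Σ≡1
  Signed-binary (ends-with-−s _ _ Σ≡0) = inj₁ Σ≡0

  prefix-binary : Σℤ M f ≡ 1ℤ → ∀ k → k ≤ M → Σℤ k f ≡ 0ℤ ⊎ Σℤ k f ≡ 1ℤ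
  prefix-binary total k k≤M with iterate Prefix-step z≤n k≤M (all-zero λ _ ())
  ... | all-zero zeros = inj₁ (trans (Σℤ-cong k zeros) (Σℤ-zero k))
  ... | signed s σ with Signed-total total (iterate Signed-step k≤M NP.≤-refl σ)
  ...   | refl = Signed-binary σ

Binary : ℤ → Set
Binary z = z ≡ 0ℤ ⊎ z ≡ 1ℤ

binary-nonneg : ∀ {z} → Binary z → 0ℤ ≤ℤ z
binary-nonneg (inj₁ refl) = ZP.≤-refl
binary-nonneg (inj₂ refl) = +≤+ z≤n

binary-bound : ∀ m {z} → Binary z → + m +ℤ z ≤ℤ + suc m
binary-bound m (inj₁ refl) = +≤+ (NP.≤-trans (NP.≤-reflexive (NP.+-identityʳ m)) (NP.n≤1+n m))
binary-bound m (inj₂ refl) = +≤+ (NP.≤-reflexive (NP.+-comm m 1))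

binary-cancel : ∀ m {z} → Binary z → + m +ℤ z ≡ + suc m → z ≡ 1ℤ
binary-cancel m (inj₁ refl) eq = ⊥-elim (NP.1+n≢n (sym (trans (sym (NP.+-identityʳ m)) (ZP.+-injective eq))))
binary-cancel m (inj₂ refl) _  = refl

binary-indicator : ∀ {z} {P : Set} → Binary z → (z ≡ 1ℤ ⇔ P) → (p : Dec P) → z ≡ + indicator p
binary-indicator (inj₁ refl) z≡1⇔P (yes p) with Equivalence.from z≡1⇔P p
... | ()
binary-indicator (inj₂ refl) _      (yes _) = refl
binary-indicator (inj₁ refl) _      (no _)  = refl
binary-indicator (inj₂ refl) z≡1⇔P (no ¬p) = ⊥-elim (¬p (Equivalence.to z≡1⇔P refl))

row-prefix-binary : ∀ {n a} → IsASM n a → ∀ {i} → i < n → ∀ k → k ≤ n → Binary (Σℤ k (a i))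
row-prefix-binary {n} {a} asm {i} i<n =
  Alternating.prefix-binary (a i) n (λ j j<n → entries i j i<n j<n) (λ j j' → rowAlt i j j' i<n)
                            (rowSum i i<n)
  where open IsASM asm

colPartial-binary : ∀ {n a} → IsASM n a → ∀ {i j} → i < n → j < n → Binary (colPartial a i j)
colPartial-binary {n} {a} asm {i} {j} i<n j<n =
  Alternating.prefix-binary (λ r → a r j) n (λ r r<n → entries r j r<n j<n) (λ r r' → colAlt j r r' j<n)
                            (colSum j j<n) (suc i) i<n
  where open IsASM asm

onesBefore : Matrix → ℕ → ℕ → ℤ
onesBefore a i M = Σℤ M (colPartial a i)

onesBefore-suc : ∀ a i M → onesBefore a (suc i) M ≡ onesBefore a i M +ℤ Σℤ M (a (suc i))
onesBefore-suc a i M = Σℤ-distrib-+ M (colPartial a i) (a (suc i))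

module OnesRow {n a d} (asm : IsASM n a) (ones : IsOnesPositions n a d) {r} (r<n : r < n) where
  open IsOnesPositions ones
  open Enumeration (λ k k' → increasing r k k' r<n) (inRange r r r<n NP.≤-refl) public

  colPartial-supported : Supported (colPartial a r)
  colPartial-supported x x<n with colPartial-binary asm r<n x<n
  ... | inj₁ c≡0 = inj₁ c≡0
  ... | inj₂ c≡1 = inj₂ (allOnes r x r<n x<n c≡1)

  onesBefore-at : ∀ k → k ≤ r → onesBefore a r (d r k) ≡ + k
  onesBefore-at k k≤r = begin
    onesBefore a r (d r k)
      ≡⟨ Σℤ-below colPartial-supported k k≤r ⟩
    Σℤ k (λ t → colPartial a r (d r t))
      ≡⟨ Σℤ-cong k (λ t t<k → areOnes r t r<n (NP.<⇒≤ (NP.<-≤-trans t<k k≤r))) ⟩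
    Σℤ k (λ _ → 1ℤ)
      ≡⟨ Σℤ-ones k ⟩
    + k ∎
    where open ≡-Reasoning

  onesBefore-after : ∀ k → k ≤ r → onesBefore a r (suc (d r k)) ≡ + suc k
  onesBefore-after k k≤r =
    trans (cong₂ _+ℤ_ (onesBefore-at k k≤r) (areOnes r k r<n k≤r)) (cong +_ (NP.+-comm k 1))

  onesBefore-mono : ∀ {M M'} → M ≤ M' → M' ≤ n → onesBefore a r M ≤ℤ onesBefore a r M'
  onesBefore-mono M≤M' M'≤n = Σℤ-mono-≤ (colPartial a r) M≤M'
    λ t t<M' → binary-nonneg (colPartial-binary asm r<n (NP.<-≤-trans t<M' M'≤n))

-- Consecutive rows of the monotone triangle

Aligned : (ℕ → ℕ → ℕ) → ℕ → ℕ → Set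
Aligned d i k = d i k ≡ d (suc i) (suc k)

module Interlacing {n a d} (asm : IsASM n a) (ones : IsOnesPositions n a d) {i} (1+i<n : suc i < n) where
  open IsOnesPositions ones

  i<n : i < n
  i<n = NP.<-trans (NP.n<1+n i) 1+i<n

  module Row₀ = OnesRow asm ones i<n
  module Row₁ = OnesRow asm ones 1+i<n

  ρ : ℕ → ℤ
  ρ M = Σℤ M (a (suc i))

  module _ {k} (k≤i : k ≤ i) where

    private
      x = d i k
      y = d (suc i) (suc k)
      x<n = inRange i k i<n k≤i
      1+k≤1+i = s≤s k≤i

    ρ-one⇒aligned : ρ (suc x) ≡ 1ℤ → Aligned d i k
    ρ-one⇒aligned ρ≡1 with NP.<-cmp x y
    ... | tri≈ _ x≡y _ = x≡y
    ... | tri< x<y _ _ = ⊥-elim (NP.n≮n (suc k) (ZP.drop‿+≤+ (begin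
      + suc (suc k)                ≡⟨ count ⟨
      onesBefore a (suc i) (suc x) ≤⟨ Row₁.onesBefore-mono x<y (NP.<⇒≤ (inRange (suc i) (suc k) 1+i<n 1+k≤1+i)) ⟩
      onesBefore a (suc i) y       ≡⟨ Row₁.onesBefore-at (suc k) 1+k≤1+i ⟩
      + suc k                      ∎)))
      where
      open ZP.≤-Reasoning
      count : onesBefore a (suc i) (suc x) ≡ + suc (suc k)
      count = trans (onesBefore-suc a i (suc x))
                    (trans (cong₂ _+ℤ_ (Row₀.onesBefore-after k k≤i) ρ≡1) (cong +_ (NP.+-comm (suc k) 1)))
    ... | tri> _ _ y<x = ⊥-elim (NP.n≮n (suc k) (ZP.drop‿+≤+ (begin
      + suc (suc k)                ≡⟨ Row₁.onesBefore-after (suc k) 1+k≤1+i ⟨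
      onesBefore a (suc i) (suc y) ≤⟨ Row₁.onesBefore-mono y<x (NP.<⇒≤ x<n) ⟩
      onesBefore a (suc i) x       ≡⟨ onesBefore-suc a i x ⟩
      onesBefore a i x +ℤ ρ x      ≡⟨ cong (_+ℤ ρ x) (Row₀.onesBefore-at k k≤i) ⟩
      + k +ℤ ρ x                   ≤⟨ binary-bound k (row-prefix-binary asm 1+i<n x (NP.<⇒≤ x<n)) ⟩
      + suc k                      ∎)))
      where open ZP.≤-Reasoning

    aligned⇒ρ-one : Aligned d i k → ρ (suc x) ≡ 1ℤ
    aligned⇒ρ-one x≡y = binary-cancel (suc k) (row-prefix-binary asm 1+i<n (suc x) x<n) (begin
      + suc k +ℤ ρ (suc x)                    ≡⟨ cong (_+ℤ ρ (suc x)) (Row₀.onesBefore-after k k≤i) ⟨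
      onesBefore a i (suc x) +ℤ ρ (suc x)     ≡⟨ onesBefore-suc a i (suc x) ⟨
      onesBefore a (suc i) (suc x)            ≡⟨ cong (λ z → onesBefore a (suc i) (suc z)) x≡y ⟩
      onesBefore a (suc i) (suc y)            ≡⟨ Row₁.onesBefore-after (suc k) 1+k≤1+i ⟩
      + suc (suc k)                           ∎)
      where open ≡-Reasoning

    Cond⇔Aligned : Cond d i k ⇔ Aligned d i k
    Cond⇔Aligned = mk⇔ to from
      where
      to : Cond d i k → Aligned d i k
      to (_ , shifted) = NP.+-cancelʳ-≡ k x y (NP.suc-injective (trans shifted (NP.+-suc y k)))
      from : Aligned d i k → Cond d i k
      from x≡y = NP.+-monoˡ-≤ k (NP.<⇒≤ (subst (d (suc i) k <_) (sym x≡y)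
                   (increasing (suc i) k (suc k) 1+i<n (NP.n<1+n k) 1+k≤1+i)))
               , trans (cong (λ z → suc (z + k)) x≡y) (sym (NP.+-suc y k))

    ρ-indicator : ρ (suc x) ≡ + indicator (cond? d i k)
    ρ-indicator = binary-indicator (row-prefix-binary asm 1+i<n (suc x) x<n)
      (⇔-trans (mk⇔ ρ-one⇒aligned aligned⇒ρ-one) (⇔-sym Cond⇔Aligned)) (cond? d i k)

  row-contribution : Σℤ n (λ j → colPartial a i j *ℤ ρ (suc j)) ≡ + Σℕ (suc i) (λ k → indicator (cond? d i k))
  row-contribution = begin
    Σℤ n (λ j → colPartial a i j *ℤ ρ (suc j))
      ≡⟨ Row₀.Σℤ-all (Row₀.supported-*ʳ (λ j → ρ (suc j)) Row₀.colPartial-supported) ⟩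
    Σℤ (suc i) (λ k → colPartial a i (d i k) *ℤ ρ (suc (d i k)))
      ≡⟨ Σℤ-cong (suc i) (λ k k<1+i → trans (cong₂ _*ℤ_ (areOnes i k i<n (NP.≤-pred k<1+i)) (ρ-indicator (NP.≤-pred k<1+i)))
                                            (ZP.*-identityˡ _)) ⟩
    Σℤ (suc i) (λ k → + indicator (cond? d i k))
      ≡⟨ pos-Σℕ (suc i) (λ k → indicator (cond? d i k)) ⟨
    + Σℕ (suc i) (λ k → indicator (cond? d i k)) ∎
    where open ≡-Reasoning

-- The summand of lhs is local to its definition, so the left side of lhs-summand is
-- left for unification with its use in lhs-guarded.
mutual
  lhs-guarded : ∀ n a → lhs n a ≡ Σℤ n λ i → Σℤ n λ i' → Σℤ n λ j → Σℤ n λ j' →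
                                   guard (i <? i') (a i j) *ℤ guard (j' ≤? j) (a i' j')
  lhs-guarded n a =
    Σℤ-cong n λ i _ → Σℤ-cong n λ i' _ → Σℤ-cong n λ j _ → Σℤ-cong n λ j' _ → lhs-summand n a i i' j j'

  lhs-summand : ∀ n a i i' j j' → _ ≡ guard (i <? i') (a i j) *ℤ guard (j' ≤? j) (a i' j')
  lhs-summand n a i i' j j' with i <? i' | j' ≤? j
  ... | yes _ | yes _ = refl
  ... | yes _ | no _  = sym (ZP.*-zeroʳ (a i j))
  ... | no _  | _     = refl

lhs-factorised : ∀ n a → lhs n a ≡ Σℤ n λ i' → Σℤ n λ j → Σℤ i' (λ i → a i j) *ℤ Σℤ (suc j) (a i')
lhs-factorised n a = begin
  lhs n a
    ≡⟨ lhs-guarded n a ⟩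
  (Σℤ n λ i → Σℤ n λ i' → Σℤ n λ j → Σℤ n λ j' → above i i' j *ℤ left i' j j')
    ≡⟨ Σℤ-cong n (λ i _ → Σℤ-cong n λ i' _ → Σℤ-cong n λ j _ → *-distribˡ-Σℤ n (above i i' j) (left i' j)) ⟨
  (Σℤ n λ i → Σℤ n λ i' → Σℤ n λ j → above i i' j *ℤ Σℤ n (left i' j))
    ≡⟨ Σℤ-comm n n _ ⟩
  (Σℤ n λ i' → Σℤ n λ i → Σℤ n λ j → above i i' j *ℤ Σℤ n (left i' j))
    ≡⟨ Σℤ-cong n (λ i' _ → Σℤ-comm n n _) ⟩
  (Σℤ n λ i' → Σℤ n λ j → Σℤ n λ i → above i i' j *ℤ Σℤ n (left i' j))
    ≡⟨ Σℤ-cong n (λ i' _ → Σℤ-cong n λ j _ → *-distribʳ-Σℤ n (Σℤ n (left i' j)) (λ i → above i i' j)) ⟨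
  (Σℤ n λ i' → Σℤ n λ j → Σℤ n (λ i → above i i' j) *ℤ Σℤ n (left i' j))
    ≡⟨ Σℤ-cong n (λ i' i'<n → Σℤ-cong n λ j j<n → cong₂ _*ℤ_
         (Σℤ-guard (λ i → i <? i') (λ i → a i j) (NP.<⇒≤ i'<n) (λ _ → mk⇔ id id))
         (Σℤ-guard (λ j' → j' ≤? j) (a i') j<n (λ _ → mk⇔ s≤s NP.≤-pred))) ⟩
  (Σℤ n λ i' → Σℤ n λ j → Σℤ i' (λ i → a i j) *ℤ Σℤ (suc j) (a i')) ∎
  where
  open ≡-Reasoning
  above : ℕ → ℕ → ℕ → ℤ
  above i i' j = guard (i <? i') (a i j)
  left : ℕ → ℕ → ℕ → ℤ
  left i' j j' = guard (j' ≤? j) (a i' j')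

mainTheorem9 : (n : ℕ) (a : Matrix) (d : ℕ → ℕ → ℕ) →
               IsASM n a → IsOnesPositions n a d →
               lhs n a ≡ + rhs n d
mainTheorem9 zero    a d asm ones = refl
mainTheorem9 (suc m) a d asm ones = begin
  lhs (suc m) a
    ≡⟨ lhs-factorised (suc m) a ⟩
  Σℤ (suc m) (λ i' → Σℤ (suc m) λ j → Σℤ i' (λ i → a i j) *ℤ Σℤ (suc j) (a i'))
    ≡⟨ Σℤ-suc m _ ⟩
  Σℤ (suc m) (λ _ → 0ℤ) +ℤ Σℤ m rows
    ≡⟨ trans (cong (_+ℤ Σℤ m rows) (Σℤ-zero (suc m))) (ZP.+-identityˡ _) ⟩
  Σℤ m rows
    ≡⟨ Σℤ-cong m (λ i i<m → Interlacing.row-contribution asm ones (s≤s i<m)) ⟩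
  Σℤ m (λ i → + Σℕ (suc i) (λ k → indicator (cond? d i k)))
    ≡⟨ pos-Σℕ m (λ i → Σℕ (suc i) (λ k → indicator (cond? d i k))) ⟨
  + rhs (suc m) d ∎
  where
  open ≡-Reasoning
  rows : ℕ → ℤ
  rows i = Σℤ (suc m) λ j → colPartial a i j *ℤ Σℤ (suc j) (a (suc i))
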